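{- Let $\nu$ be a lattice path whose left area vector $\mathbf{LA}_\nu$ has no repeated entries. If $D,D'$ are $\nu$-Dyck paths with $D\le_T D'$ in the $\nu$-Tamari order, then the out-degree of $D$ is at least the out-degree of $D'$.
   Context: Let $\nu$ be a lattice path from $(0,0)$ to $(s_E,s_N)$ with unit north ($N$) and east ($E$) steps. A $\nu$-Dyck path is a lattice path from $(0,0)$ to $(s_E,s_N)$ with $N$ and $E$ steps lying weakly above $\nu$ ($\nu$ itself is one). For a $\nu$-Dyck path $D$ and $i\in[s_N]$, $r_i^D$ is the point of $D$ immediately before its $i$-th north step, and the left area vector is $\mathbf{LA}_D=(x_1,\dots,x_{s_N})$ with $x_i$ the $x$-coordinate of $r_i^D$. For $p=(x,y)$ on $D$, $\mathrm{horiz}_\nu(p)=X(y)-x$ with $X(y)$ the largest $x$-coordinate of a point of $\nu$ at height $y$. The touch point $t_i^D$ is the first point of $D$ after $r_i^D$ with the same horizontal distance as $r_i^D$. If $r_i^D$ is preceded by an east step, write $D=dEtf$ ($dE$ = subpath from $(0,0)$ to $r_i^D$, $t$ = subpath from $r_i^D$ to $t_i^D$, $f$ = the rest) and set $D\uparrow_i=dtEf$. The $\nu$-Tamari order $\le_T$ is the partial order whose cover relations are $D\lessdot_T D\uparrow_i$ whenever defined. The out-degree of $D$ is the number of elements covering $D$. -}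

module Defs where

open import Data.Nat using (ℕ; zero; suc; _≤_; _<_; _∸_; _⊔_; _≡ᵇ_)
open import Data.Nat.Properties using (_≟_)
open import Data.Bool using (Bool; true; false; if_then_else_)
open import Data.Product using (_×_; _,_; proj₁; proj₂; ∃-syntax)
open import Data.List using (List; []; _∷_; _++_; take; drop; length; map; foldr; filter; upTo; deduplicate)
open import Data.List.Relation.Unary.All using (All)
open import Data.Maybe using (Maybe; just; nothing; _>>=_)
open import Data.List using (catMaybes)
import Data.Maybe as M
open import Relation.Binary.PropositionalEquality using (_≡_; refl)
open import Relation.Nullary using (Dec; yes; no)
open import Relation.Binary.Construct.Closure.ReflexiveTransitive using (Star)
import Data.List.Properties as LP

data Step : Set where
  N E : Step

Step-≟ : (a b : Step) → Dec (a ≡ b)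
Step-≟ N N = yes refl
Step-≟ E E = yes refl
Step-≟ N E = no (λ ())
Step-≟ E N = no (λ ())

Path : Set
Path = List Step

Path-≟ : (p q : Path) → Dec (p ≡ q)
Path-≟ = LP.≡-dec Step-≟

countN : Path → ℕ
countN [] = 0
countN (N ∷ p) = suc (countN p)
countN (E ∷ p) = countN p

countE : Path → ℕ
countE [] = 0
countE (N ∷ p) = countE p
countE (E ∷ p) = suc (countE p)

pointsFrom : ℕ → ℕ → Path → List (ℕ × ℕ)
pointsFrom x y [] = (x , y) ∷ []
pointsFrom x y (N ∷ p) = (x , y) ∷ pointsFrom x (suc y) p
pointsFrom x y (E ∷ p) = (x , y) ∷ pointsFrom (suc x) y p

points : Path → List (ℕ × ℕ)
points = pointsFrom 0 0

pointAt : Path → ℕ → ℕ × ℕ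
pointAt D k = (countE (take k D) , countN (take k D))

Xν : Path → ℕ → ℕ
Xν ν y = foldr _⊔_ 0 (map proj₁ (filter (λ p → proj₂ p ≟ y) (points ν)))

-- horizontal distance horiz_ν(p) = X(y) - x  (nonnegative for points of ν-Dyck paths)
horiz : Path → ℕ × ℕ → ℕ
horiz ν (x , y) = Xν ν y ∸ x

-- ν-Dyck path: same endpoint (s_E , s_N) as ν and weakly above ν,
-- i.e. every point (x , y) of D satisfies x ≤ X(y).
IsDyck : Path → Path → Set
IsDyck ν D = (countN D ≡ countN ν) × (countE D ≡ countE ν)
           × All (λ p → proj₁ p ≤ Xν ν (proj₂ p)) (points D)

LAfrom : ℕ → Path → List ℕ
LAfrom x [] = []
LAfrom x (N ∷ p) = x ∷ LAfrom x p
LAfrom x (E ∷ p) = LAfrom (suc x) p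

LA : Path → List ℕ
LA = LAfrom 0

-- index (number of preceding steps) of the north step number i (0-indexed)
nthN : Path → ℕ → Maybe ℕ
nthN [] _ = nothing
nthN (N ∷ p) zero = just 0
nthN (N ∷ p) (suc i) = M.map suc (nthN p i)
nthN (E ∷ p) i = M.map suc (nthN p i)

isEAt : Path → ℕ → Bool
isEAt D k with drop k D
... | E ∷ _ = true
... | _ = false

search : (ℕ → Bool) → ℕ → ℕ → Maybe ℕ
search f s zero = nothing
search f s (suc n) = if f s then just s else search f (suc s) n

-- D↑_(i+1) (0-indexed north step i), when defined.
-- r = point before north step (index k); must be preceded by an east step (index k-1);
-- t = first later point with the same horizontal distance (index m > k);
-- D = d E t f  ↦  d t E f.
rotate : Path → Path → ℕ → Maybe Path
rotate ν D i with nthN D i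
... | nothing = nothing
... | just zero = nothing
... | just (suc k') with isEAt D k'
...   | false = nothing
...   | true with search (λ m → horiz ν (pointAt D m) ≡ᵇ horiz ν (pointAt D (suc k')))
                         (suc (suc k')) (length D ∸ suc k')
...     | nothing = nothing
...     | just m = just (take k' D ++ (drop (suc k') (take m D) ++ (E ∷ drop m D)))

Cover : Path → Path → Path → Set
Cover ν D D' = IsDyck ν D × ∃[ i ] (i < countN ν × rotate ν D i ≡ just D')

_≤T[_]_ : Path → Path → Path → Set
D ≤T[ ν ] D' = Star (Cover ν) D D'

outdeg : Path → Path → ℕ
outdeg ν D = length (deduplicate Path-≟ (catMaybes (map (rotate ν D) (upTo (countN ν)))))

-- The out-degree of a ν-Dyck path D equals its number of valleys (factors E N). The horizontal
-- distance to ν never decreases along a north step, drops by one along an east step and is 0 at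
-- the end of D, so every north step preceded by an east step has a touch point and D↑_i is defined
-- exactly at such steps; rotations at different steps already differ at the first of the two valleys.
-- A rotation d E N t f ↦ d N t E f destroys the valley E N, creates at most one valley d N (when d
-- ends with E), and creates one at E f only when f starts with N. In that case t ends with E, so the
-- valley between t and f is lost: t is not empty, because distinct entries of LA ν make X strictly
-- increasing, so two consecutive north steps move strictly away from ν; and its last step is not N,
-- because the distance stays above its value at r_i until the touch point. So valleys, and hence
-- out-degrees, weakly decrease along the order.
module Submission where

open import Defs
open import Data.Bool using (Bool; true; false; T)
open import Data.Empty using (⊥; ⊥-elim)
open import Data.List using (List; []; _∷_; _++_; take; drop; length; map; filter; foldr; applyUpTo; upTo; catMaybes; deduplicate)
open import Data.List.Properties using (take++drop≡id; take-all; ++-assoc; ++-cancelˡ; filter-all)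
open import Data.List.Relation.Unary.All using (All; []; _∷_)
open import Data.List.Relation.Unary.AllPairs using ([]; _∷_)
open import Data.List.Relation.Unary.Unique.Propositional using (Unique)
open import Data.Maybe using (Maybe; just; nothing; is-just)
open import Data.Maybe.Properties using (just-injective)
open import Data.Nat
open import Data.Nat.Properties
open import Data.Product using (_×_; _,_; proj₁; proj₂; ∃-syntax)
open import Data.Sum using (inj₁; inj₂)
open import Data.Unit using (tt)
open import Function using (_∘_; id; case_of_)
open import Relation.Binary.Construct.Closure.ReflexiveTransitive using (ε; _◅_)
open import Relation.Binary.Definitions using (DecidableEquality; tri<; tri≈; tri>)
open import Relation.Binary.PropositionalEquality
open import Relation.Nullary using (yes; no; ¬_)

-- The abscissa X(y) of ν

maxXAt : List (ℕ × ℕ) → ℕ → ℕ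
maxXAt ps z = foldr _⊔_ 0 (map proj₁ (filter (λ p → proj₂ p ≟ z) ps))

-- Xν ν is Xfrom 0 0 ν by definition; the starting point is generalised for induction along ν.
Xfrom : ℕ → ℕ → Path → ℕ → ℕ
Xfrom x y p = maxXAt (pointsFrom x y p)

maxXAt-∷-≡ : ∀ x y ps → maxXAt ((x , y) ∷ ps) y ≡ x ⊔ maxXAt ps y
maxXAt-∷-≡ x y ps with y ≡ᵇ y in y≡ᵇy
... | true = refl
... | false = ⊥-elim (subst T y≡ᵇy (≡⇒≡ᵇ y y refl))

maxXAt-∷-≢ : ∀ x y z ps → y ≢ z → maxXAt ((x , y) ∷ ps) z ≡ maxXAt ps z
maxXAt-∷-≢ x y z ps y≢z with y ≡ᵇ z in y≡ᵇz
... | true = ⊥-elim (y≢z (≡ᵇ⇒≡ y z (subst T (sym y≡ᵇz) tt)))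
... | false = refl

maxXAt-∷-≤ : ∀ x y z ps → maxXAt ((x , y) ∷ ps) z ≤ x ⊔ maxXAt ps z
maxXAt-∷-≤ x y z ps with y ≡ᵇ z
... | true = ≤-refl
... | false = m≤n⊔m x _

Xfrom-below : ∀ x y p z → z < y → Xfrom x y p z ≡ 0
Xfrom-below x y [] z z<y = maxXAt-∷-≢ x y z [] (≢-sym (<⇒≢ z<y))
Xfrom-below x y (N ∷ p) z z<y =
  trans (maxXAt-∷-≢ x y z _ (≢-sym (<⇒≢ z<y))) (Xfrom-below x (suc y) p z (m<n⇒m<1+n z<y))
Xfrom-below x y (E ∷ p) z z<y =
  trans (maxXAt-∷-≢ x y z _ (≢-sym (<⇒≢ z<y))) (Xfrom-below (suc x) y p z z<y)

Xfrom-start : ∀ x y p → x ≤ Xfrom x y p y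
Xfrom-start x y [] = ≤-trans (m≤m⊔n x _) (≤-reflexive (sym (maxXAt-∷-≡ x y [])))
Xfrom-start x y (N ∷ p) = ≤-trans (m≤m⊔n x _) (≤-reflexive (sym (maxXAt-∷-≡ x y _)))
Xfrom-start x y (E ∷ p) = ≤-trans (m≤m⊔n x _) (≤-reflexive (sym (maxXAt-∷-≡ x y _)))

Xfrom-≤ : ∀ x y p z → Xfrom x y p z ≤ x + countE p
Xfrom-≤ x y [] z = ≤-trans (maxXAt-∷-≤ x y z []) (⊔-lub (≤-reflexive (sym (+-identityʳ x))) z≤n)
Xfrom-≤ x y (N ∷ p) z = ≤-trans (maxXAt-∷-≤ x y z _) (⊔-lub (m≤m+n x _) (Xfrom-≤ x (suc y) p z))
Xfrom-≤ x y (E ∷ p) z =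
  ≤-trans (maxXAt-∷-≤ x y z _)
          (⊔-lub (m≤m+n x _) (≤-trans (Xfrom-≤ (suc x) y p z) (≤-reflexive (sym (+-suc x _)))))

Xfrom-N-here : ∀ x y p → Xfrom x y (N ∷ p) y ≡ x
Xfrom-N-here x y p = begin
  Xfrom x y (N ∷ p) y     ≡⟨ maxXAt-∷-≡ x y _ ⟩
  x ⊔ Xfrom x (suc y) p y ≡⟨ cong (x ⊔_) (Xfrom-below x (suc y) p y ≤-refl) ⟩
  x ⊔ 0                   ≡⟨ ⊔-identityʳ x ⟩
  x                       ∎
  where open ≡-Reasoning


Xfrom-N-there : ∀ x y p z → y ≢ z → Xfrom x y (N ∷ p) z ≡ Xfrom x (suc y) p z
Xfrom-N-there x y p z = maxXAt-∷-≢ x y z _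

Xfrom-E-there : ∀ x y p z → y ≢ z → Xfrom x y (E ∷ p) z ≡ Xfrom (suc x) y p z
Xfrom-E-there x y p z = maxXAt-∷-≢ x y z _

Xfrom-mono : ∀ x y p z → y ≤ z → z < y + countN p → Xfrom x y p z ≤ Xfrom x y p (suc z)
Xfrom-mono x y [] z y≤z z<y+0 = ⊥-elim (<⇒≱ z<y+0 (≤-trans (≤-reflexive (+-identityʳ y)) y≤z))
Xfrom-mono x y (N ∷ p) z y≤z z<y+n with y ≟ z
... | yes refl = begin
  Xfrom x y (N ∷ p) y            ≡⟨ Xfrom-N-here x y p ⟩
  x                              ≤⟨ Xfrom-start x (suc y) p ⟩
  Xfrom x (suc y) p (suc y)      ≡⟨ Xfrom-N-there x y p (suc y) (<⇒≢ ≤-refl) ⟨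
  Xfrom x y (N ∷ p) (suc y)      ∎
  where open ≤-Reasoning
... | no y≢z = begin
  Xfrom x y (N ∷ p) z            ≡⟨ Xfrom-N-there x y p z y≢z ⟩
  Xfrom x (suc y) p z            ≤⟨ Xfrom-mono x (suc y) p z (≤∧≢⇒< y≤z y≢z) (≤-trans z<y+n (≤-reflexive (+-suc y _))) ⟩
  Xfrom x (suc y) p (suc z)      ≡⟨ Xfrom-N-there x y p (suc z) (<⇒≢ (s≤s y≤z)) ⟨
  Xfrom x y (N ∷ p) (suc z)      ∎
  where open ≤-Reasoning
Xfrom-mono x y (E ∷ p) z y≤z z<y+n with y ≟ z
... | yes refl = begin
  Xfrom x y (E ∷ p) y                ≡⟨ maxXAt-∷-≡ x y _ ⟩
  x ⊔ Xfrom (suc x) y p y            ≤⟨ ⊔-lub (≤-trans (n≤1+n x) (≤-trans (Xfrom-start (suc x) y p) IH)) IH ⟩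
  Xfrom (suc x) y p (suc y)          ≡⟨ Xfrom-E-there x y p (suc y) (<⇒≢ ≤-refl) ⟨
  Xfrom x y (E ∷ p) (suc y)          ∎
  where
  open ≤-Reasoning
  IH = Xfrom-mono (suc x) y p y ≤-refl z<y+n
... | no y≢z = begin
  Xfrom x y (E ∷ p) z            ≡⟨ Xfrom-E-there x y p z y≢z ⟩
  Xfrom (suc x) y p z            ≤⟨ Xfrom-mono (suc x) y p z y≤z z<y+n ⟩
  Xfrom (suc x) y p (suc z)      ≡⟨ Xfrom-E-there x y p (suc z) (<⇒≢ (s≤s y≤z)) ⟨
  Xfrom x y (E ∷ p) (suc z)      ∎
  where open ≤-Reasoning

Xfrom-start-< : ∀ x y p → All (x ≢_) (LAfrom x p) → 0 < countN p → x < Xfrom x y p y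
Xfrom-start-< x y (N ∷ p) (x≢x ∷ _) _ = ⊥-elim (x≢x refl)
Xfrom-start-< x y (E ∷ p) _ _ = begin-strict
  x                       <⟨ n<1+n x ⟩
  suc x                   ≤⟨ Xfrom-start (suc x) y p ⟩
  Xfrom (suc x) y p y     ≤⟨ m≤n⊔m x _ ⟩
  x ⊔ Xfrom (suc x) y p y ≡⟨ maxXAt-∷-≡ x y _ ⟨
  Xfrom x y (E ∷ p) y     ∎
  where open ≤-Reasoning

Xfrom-strict : ∀ x y p z → Unique (LAfrom x p) → y ≤ z → suc z < y + countN p
             → Xfrom x y p z < Xfrom x y p (suc z)
Xfrom-strict x y [] z _ y≤z sz<y+0 =
  ⊥-elim (<⇒≱ sz<y+0 (≤-trans (≤-reflexive (+-identityʳ y)) (≤-trans y≤z (n≤1+n _))))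
Xfrom-strict x y (N ∷ p) z (x∉ ∷ u) y≤z sz<y+n with y ≟ z
... | yes refl = begin-strict
  Xfrom x y (N ∷ p) y            ≡⟨ Xfrom-N-here x y p ⟩
  x                              <⟨ Xfrom-start-< x (suc y) p x∉ (countN-pos y (countN p) sz<y+n) ⟩
  Xfrom x (suc y) p (suc y)      ≡⟨ Xfrom-N-there x y p (suc y) (<⇒≢ ≤-refl) ⟨
  Xfrom x y (N ∷ p) (suc y)      ∎
  where
  open ≤-Reasoning
  countN-pos : ∀ y c → suc (suc y) ≤ y + suc c → 0 < c
  countN-pos y zero  ssy≤y+1 = ⊥-elim (1+n≰n (≤-trans ssy≤y+1 (≤-reflexive (+-comm y 1))))
  countN-pos y (suc c) _ = z<s
... | no y≢z = begin-strict
  Xfrom x y (N ∷ p) z            ≡⟨ Xfrom-N-there x y p z y≢z ⟩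
  Xfrom x (suc y) p z            <⟨ Xfrom-strict x (suc y) p z u (≤∧≢⇒< y≤z y≢z) (≤-trans sz<y+n (≤-reflexive (+-suc y _))) ⟩
  Xfrom x (suc y) p (suc z)      ≡⟨ Xfrom-N-there x y p (suc z) (<⇒≢ (s≤s y≤z)) ⟨
  Xfrom x y (N ∷ p) (suc z)      ∎
  where open ≤-Reasoning
Xfrom-strict x y (E ∷ p) z u y≤z sz<y+n with y ≟ z
... | yes refl = begin-strict
  Xfrom x y (E ∷ p) y                ≡⟨ maxXAt-∷-≡ x y _ ⟩
  x ⊔ Xfrom (suc x) y p y            <⟨ ⊔-lub (≤-trans (Xfrom-start (suc x) y p) (<⇒≤ IH)) IH ⟩
  Xfrom (suc x) y p (suc y)          ≡⟨ Xfrom-E-there x y p (suc y) (<⇒≢ ≤-refl) ⟨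
  Xfrom x y (E ∷ p) (suc y)          ∎
  where
  open ≤-Reasoning
  IH = Xfrom-strict (suc x) y p y u ≤-refl sz<y+n
... | no y≢z = begin-strict
  Xfrom x y (E ∷ p) z            ≡⟨ Xfrom-E-there x y p z y≢z ⟩
  Xfrom (suc x) y p z            <⟨ Xfrom-strict (suc x) y p z u y≤z sz<y+n ⟩
  Xfrom (suc x) y p (suc z)      ≡⟨ Xfrom-E-there x y p (suc z) (<⇒≢ (s≤s y≤z)) ⟨
  Xfrom x y (E ∷ p) (suc z)      ∎
  where open ≤-Reasoning

Xν-mono : ∀ ν y → y < countN ν → Xν ν y ≤ Xν ν (suc y)
Xν-mono ν y = Xfrom-mono 0 0 ν y z≤n

Xν-strict : ∀ ν y → Unique (LA ν) → suc y < countN ν → Xν ν y < Xν ν (suc y)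
Xν-strict ν y u = Xfrom-strict 0 0 ν y u z≤n

Xν≤countE : ∀ ν y → Xν ν y ≤ countE ν
Xν≤countE ν y = Xfrom-≤ 0 0 ν y

stepE stepN : Step → ℕ
stepE N = 0
stepE E = 1
stepN N = 1
stepN E = 0

countE-take-suc : ∀ j (D : Path) {s r} → drop j D ≡ s ∷ r → countE (take (suc j) D) ≡ stepE s + countE (take j D)
countE-take-suc zero    (N ∷ D) refl = refl
countE-take-suc zero    (E ∷ D) refl = refl
countE-take-suc (suc j) (N ∷ D) eq = countE-take-suc j D eq
countE-take-suc (suc j) (E ∷ D) eq = trans (cong suc (countE-take-suc j D eq)) (sym (+-suc _ _))

countN-take-suc : ∀ j (D : Path) {s r} → drop j D ≡ s ∷ r → countN (take (suc j) D) ≡ stepN s + countN (take j D)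
countN-take-suc zero    (N ∷ D) refl = refl
countN-take-suc zero    (E ∷ D) refl = refl
countN-take-suc (suc j) (N ∷ D) eq = trans (cong suc (countN-take-suc j D eq)) (sym (+-suc _ _))
countN-take-suc (suc j) (E ∷ D) eq = countN-take-suc j D eq

countN-++ : ∀ (a b : Path) → countN (a ++ b) ≡ countN a + countN b
countN-++ []      b = refl
countN-++ (N ∷ a) b = cong suc (countN-++ a b)
countN-++ (E ∷ a) b = countN-++ a b

countN-take+drop : ∀ j (D : Path) → countN D ≡ countN (take j D) + countN (drop j D)
countN-take+drop j D = trans (cong countN (sym (take++drop≡id j D))) (countN-++ (take j D) (drop j D))

∃-drop≡∷ : ∀ j (D : Path) → j < length D → ∃[ s ] ∃[ r ] drop j D ≡ s ∷ r
∃-drop≡∷ zero    (s ∷ D) _ = s , D , refl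
∃-drop≡∷ (suc j) (s ∷ D) (s≤s j<len) = ∃-drop≡∷ j D j<len

drop≡∷⇒<length : ∀ j (D : Path) {s r} → drop j D ≡ s ∷ r → j < length D
drop≡∷⇒<length zero    (_ ∷ D) _  = z<s
drop≡∷⇒<length (suc j) (_ ∷ D) eq = s≤s (drop≡∷⇒<length j D eq)

drop-suc≡tail : ∀ k (D : Path) {s r} → drop k D ≡ s ∷ r → drop (suc k) D ≡ r
drop-suc≡tail zero    (_ ∷ D) refl = refl
drop-suc≡tail (suc k) (_ ∷ D) eq = drop-suc≡tail k D eq

drop-take≡∷ : ∀ k j (D : Path) {s r} → drop k D ≡ s ∷ r → k < j → drop k (take j D) ≡ s ∷ drop (suc k) (take j D)
drop-take≡∷ zero    (suc j) (_ ∷ D) refl _ = refl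
drop-take≡∷ (suc k) (suc j) (_ ∷ D) eq (s≤s k<j) = drop-take≡∷ k j D eq k<j

take≡take++∷ : ∀ k j (D : Path) {s r} → drop k D ≡ s ∷ r → k < j → take j D ≡ take k D ++ s ∷ drop (suc k) (take j D)
take≡take++∷ zero    (suc j) (_ ∷ D) refl _ = refl
take≡take++∷ (suc k) (suc j) (x ∷ D) eq (s≤s k<j) = cong (x ∷_) (take≡take++∷ k j D eq k<j)

drop≡drop-take++drop : ∀ k m (D : Path) → k ≤ m → drop k D ≡ drop k (take m D) ++ drop m D
drop≡drop-take++drop zero    m       D       _ = sym (take++drop≡id m D)
drop≡drop-take++drop (suc k) (suc m) []      _ = refl
drop≡drop-take++drop (suc k) (suc m) (_ ∷ D) (s≤s k≤m) = drop≡drop-take++drop k m D k≤m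

All-pointsFrom-take : ∀ (Q : ℕ × ℕ → Set) x y (D : Path) j → All Q (pointsFrom x y D) → j ≤ length D
                    → Q (x + countE (take j D) , y + countN (take j D))
All-pointsFrom-take Q x y []      zero (q ∷ _) _ = subst Q (sym (cong₂ _,_ (+-identityʳ x) (+-identityʳ y))) q
All-pointsFrom-take Q x y (N ∷ D) zero (q ∷ _) _ = subst Q (sym (cong₂ _,_ (+-identityʳ x) (+-identityʳ y))) q
All-pointsFrom-take Q x y (E ∷ D) zero (q ∷ _) _ = subst Q (sym (cong₂ _,_ (+-identityʳ x) (+-identityʳ y))) q
All-pointsFrom-take Q x y (N ∷ D) (suc j) (_ ∷ qs) (s≤s j≤len) =
  subst Q (cong₂ _,_ refl (sym (+-suc y _))) (All-pointsFrom-take Q x (suc y) D j qs j≤len)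
All-pointsFrom-take Q x y (E ∷ D) (suc j) (_ ∷ qs) (s≤s j≤len) =
  subst Q (cong₂ _,_ (sym (+-suc x _)) refl) (All-pointsFrom-take Q (suc x) y D j qs j≤len)

isE : Path → Bool
isE (E ∷ _) = true
isE _       = false

isEAt≡isE-drop : ∀ D k → isEAt D k ≡ isE (drop k D)
isEAt≡isE-drop D k with drop k D
... | []    = refl
... | N ∷ _ = refl
... | E ∷ _ = refl

isEAt⇒drop≡E∷ : ∀ D k → isEAt D k ≡ true → drop k D ≡ E ∷ drop (suc k) D
isEAt⇒drop≡E∷ D k isEAt≡true = go (drop k D) refl (trans (sym (isEAt≡isE-drop D k)) isEAt≡true)
  where
  go : ∀ q → drop k D ≡ q → isE q ≡ true → drop k D ≡ E ∷ drop (suc k) D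
  go (E ∷ r) eq _ = trans eq (cong (E ∷_) (sym (drop-suc≡tail k D eq)))

nthN⇒drop≡N∷ : ∀ D i k → nthN D i ≡ just k → drop k D ≡ N ∷ drop (suc k) D
nthN⇒drop≡N∷ (N ∷ D) zero .0 refl = refl
nthN⇒drop≡N∷ (N ∷ D) (suc i) k _ with nthN D i in eq
nthN⇒drop≡N∷ (N ∷ D) (suc i) .(suc k) refl | just k = nthN⇒drop≡N∷ D i k eq
nthN⇒drop≡N∷ (E ∷ D) i k _ with nthN D i in eq
nthN⇒drop≡N∷ (E ∷ D) i .(suc k) refl | just k = nthN⇒drop≡N∷ D i k eq

nthN-strictMono : ∀ D i j a b → nthN D i ≡ just a → nthN D j ≡ just b → i < j → a < b
nthN-strictMono (N ∷ D) zero (suc j) .0 b refl _ _ with nthN D j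
nthN-strictMono (N ∷ D) zero (suc j) .0 .(suc b) refl refl _ | just b = z<s
nthN-strictMono (N ∷ D) (suc i) (suc j) a b _ _ (s≤s i<j) with nthN D i in eqi | nthN D j in eqj
nthN-strictMono (N ∷ D) (suc i) (suc j) .(suc a) .(suc b) refl refl (s≤s i<j) | just a | just b =
  s≤s (nthN-strictMono D i j a b eqi eqj i<j)
nthN-strictMono (E ∷ D) i j a b _ _ i<j with nthN D i in eqi | nthN D j in eqj
nthN-strictMono (E ∷ D) i j .(suc a) .(suc b) refl refl i<j | just a | just b =
  s≤s (nthN-strictMono D i j a b eqi eqj i<j)

-- Valleys

bit : Bool → ℕ
bit true  = 1
bit false = 0

-- The flag records whether the step just before the path is E, so that a leading N counts as a valley.
valleysAfter : Bool → Path → ℕ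
valleysAfter b []      = 0
valleysAfter b (N ∷ p) = bit b + valleysAfter false p
valleysAfter b (E ∷ p) = valleysAfter true p

valleys : Path → ℕ
valleys = valleysAfter false

lastIsE : Bool → Path → Bool
lastIsE b []      = b
lastIsE b (N ∷ p) = lastIsE false p
lastIsE b (E ∷ p) = lastIsE true p

startsWithN : Path → Bool
startsWithN (N ∷ _) = true
startsWithN _       = false

valleysAfter-++ : ∀ b p q → valleysAfter b (p ++ q) ≡ valleysAfter b p + valleysAfter (lastIsE b p) q
valleysAfter-++ b []      q = refl
valleysAfter-++ b (N ∷ p) q = trans (cong (bit b +_) (valleysAfter-++ false p q)) (sym (+-assoc (bit b) _ _))
valleysAfter-++ b (E ∷ p) q = valleysAfter-++ true p q

valleysAfter-insertE : ∀ b t f → (startsWithN f ≡ true → lastIsE b t ≡ true)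
                     → valleysAfter b (t ++ E ∷ f) ≤ valleysAfter b (t ++ f)
valleysAfter-insertE b []      []      _ = z≤n
valleysAfter-insertE b []      (E ∷ f) _ = ≤-refl
valleysAfter-insertE b []      (N ∷ f) endsE rewrite endsE refl = ≤-refl
valleysAfter-insertE b (N ∷ t) f endsE = +-monoʳ-≤ (bit b) (valleysAfter-insertE false t f endsE)
valleysAfter-insertE b (E ∷ t) f endsE = valleysAfter-insertE true t f endsE

bit≤1 : ∀ b → bit b ≤ 1
bit≤1 true  = ≤-refl
bit≤1 false = z≤n

valleys-rotate-≤ : ∀ d t f → (startsWithN f ≡ true → lastIsE false t ≡ true)
                 → valleys (d ++ N ∷ (t ++ E ∷ f)) ≤ valleys (d ++ E ∷ N ∷ (t ++ f))
valleys-rotate-≤ d t f endsE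
  rewrite valleysAfter-++ false d (N ∷ (t ++ E ∷ f)) | valleysAfter-++ false d (E ∷ N ∷ (t ++ f)) =
  +-monoʳ-≤ (valleys d) (+-mono-≤ (bit≤1 (lastIsE false d)) (valleysAfter-insertE false t f endsE))

lastIsE-take-suc : ∀ m (D : Path) b {r} → drop m D ≡ E ∷ r → lastIsE b (take (suc m) D) ≡ true
lastIsE-take-suc zero    (E ∷ D) b refl = refl
lastIsE-take-suc (suc m) (N ∷ D) b eq   = lastIsE-take-suc m D false eq
lastIsE-take-suc (suc m) (E ∷ D) b eq   = lastIsE-take-suc m D true eq

lastIsE-drop-take-suc : ∀ a m (D : Path) b {r} → a ≤ m → drop m D ≡ E ∷ r → lastIsE b (drop a (take (suc m) D)) ≡ true
lastIsE-drop-take-suc zero    m       D       b _         eq = lastIsE-take-suc m D b eq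
lastIsE-drop-take-suc (suc a) (suc m) (_ ∷ D) b (s≤s a≤m) eq = lastIsE-drop-take-suc a m D b a≤m eq

startsWithN⇒ : ∀ p → startsWithN p ≡ true → ∃[ r ] p ≡ N ∷ r
startsWithN⇒ (N ∷ r) _ = r , refl

countUpTo : (ℕ → Bool) → ℕ → ℕ
countUpTo f zero    = 0
countUpTo f (suc n) = bit (f 0) + countUpTo (f ∘ suc) n

countUpTo-cong : ∀ f g n → (∀ i → f i ≡ g i) → countUpTo f n ≡ countUpTo g n
countUpTo-cong f g zero    _   = refl
countUpTo-cong f g (suc n) f≗g = cong₂ _+_ (cong bit (f≗g 0)) (countUpTo-cong (f ∘ suc) (g ∘ suc) n (f≗g ∘ suc))

precededByE : Path → Maybe ℕ → Bool
precededByE D (just (suc k)) = isEAt D k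
precededByE D _              = false

valleyAt : Path → ℕ → Bool
valleyAt D i = precededByE D (nthN D i)

isEAt-∷-suc : ∀ s p k → isEAt (s ∷ p) (suc k) ≡ isEAt p k
isEAt-∷-suc s p k = trans (isEAt≡isE-drop (s ∷ p) (suc k)) (sym (isEAt≡isE-drop p k))

valleyAt-N∷ : ∀ p i → valleyAt (N ∷ p) (suc i) ≡ valleyAt p i
valleyAt-N∷ p i with nthN p i
... | nothing    = refl
... | just zero  = refl
... | just (suc k) = isEAt-∷-suc N p k

valleyAt-EE∷ : ∀ q i → valleyAt (E ∷ E ∷ q) i ≡ valleyAt (E ∷ q) i
valleyAt-EE∷ q i with nthN q i
... | nothing = refl
... | just k  = isEAt-∷-suc E (E ∷ q) k

valleyAt-EN∷ : ∀ q i → valleyAt (E ∷ N ∷ q) (suc i) ≡ valleyAt (N ∷ q) (suc i)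
valleyAt-EN∷ q i with nthN q i
... | nothing = refl
... | just k  = isEAt-∷-suc E (N ∷ q) k

countUpTo-valleyAt : ∀ D → countUpTo (valleyAt D) (countN D) ≡ valleys D
countUpTo-valleyAt []          = refl
countUpTo-valleyAt (N ∷ p)     = trans (countUpTo-cong _ _ (countN p) (valleyAt-N∷ p)) (countUpTo-valleyAt p)
countUpTo-valleyAt (E ∷ [])    = refl
countUpTo-valleyAt (E ∷ E ∷ q) = trans (countUpTo-cong _ _ (countN q) (valleyAt-EE∷ q)) (countUpTo-valleyAt (E ∷ q))
countUpTo-valleyAt (E ∷ N ∷ q) =
  cong suc (trans (countUpTo-cong _ _ (countN q) (valleyAt-EN∷ q)) (countUpTo-valleyAt (N ∷ q)))

-- Searching for the touch point

record IsFirstHit (f : ℕ → Bool) (s n m : ℕ) : Set where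
  field
    lower  : s ≤ m
    upper  : m < s + n
    hit    : T (f m)
    before : ∀ j → s ≤ j → j < m → ¬ T (f j)

search-sound : ∀ f s n m → search f s n ≡ just m → IsFirstHit f s n m
search-sound f s (suc n) m found with f s in fs
... | true with found
...   | refl = record
  { lower  = ≤-refl
  ; upper  = ≤-trans (s≤s (m≤m+n s n)) (≤-reflexive (sym (+-suc s n)))
  ; hit    = subst T (sym fs) tt
  ; before = λ j s≤j j<s → ⊥-elim (<⇒≱ j<s s≤j)
  }
search-sound f s (suc n) m found | false = record
  { lower  = <⇒≤ lower
  ; upper  = ≤-trans upper (≤-reflexive (sym (+-suc s n)))
  ; hit    = hit
  ; before = before′
  }
  where
  open IsFirstHit (search-sound f (suc s) n m found)
  before′ : ∀ j → s ≤ j → j < m → ¬ T (f j)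
  before′ j s≤j j<m with m≤n⇒m<n∨m≡n s≤j
  ... | inj₁ s<j  = before j s<j j<m
  ... | inj₂ refl = subst T fs

-- A discrete intermediate value theorem.
search-complete : ∀ (g : ℕ → ℕ) h s n e → h ≤ g s → s ≤ e → e < s + n → g e ≤ h
                → (∀ j → s ≤ j → j < e → g j ∸ 1 ≤ g (suc j))
                → ∃[ m ] search (λ j → g j ≡ᵇ h) s n ≡ just m
search-complete g h s zero e _ s≤e e<s+0 _ _ = ⊥-elim (<⇒≱ e<s+0 (≤-trans (≤-reflexive (+-identityʳ s)) s≤e))
search-complete g h s (suc n) e h≤gs s≤e e<s+n ge≤h step with g s ≡ᵇ h in gs≡ᵇh
... | true = s , refl
... | false with m≤n⇒m<n∨m≡n s≤e
...   | inj₂ refl = ⊥-elim (gs≢h (≤-antisym ge≤h h≤gs))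
  where
  gs≢h : g s ≢ h
  gs≢h gs≡h = subst T gs≡ᵇh (≡⇒≡ᵇ (g s) h gs≡h)
...   | inj₁ s<e = search-complete g h (suc s) n e h≤gsuc s<e (≤-trans e<s+n (≤-reflexive (+-suc s n))) ge≤h
                     (λ j s<j j<e → step j (<⇒≤ s<j) j<e)
  where
  h<gs : h < g s
  h<gs = ≤∧≢⇒< h≤gs (λ h≡gs → subst T gs≡ᵇh (≡⇒≡ᵇ (g s) h (sym h≡gs)))
  h≤gsuc : h ≤ g (suc s)
  h≤gsuc = ≤-trans (∸-monoˡ-≤ 1 h<gs) (step s ≤-refl s<e)

stays-above : ∀ (g : ℕ → ℕ) h s m → h ≤ g s
            → (∀ j → s ≤ j → j < m → ¬ T (g j ≡ᵇ h))
            → (∀ j → s ≤ j → j < m → g j ∸ 1 ≤ g (suc j))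
            → ∀ j → s ≤ j → j < m → h < g j
stays-above g h s m h≤gs misses step j s≤j j<m = ≤∧≢⇒< (h≤ j s≤j j<m) (h≢ j s≤j j<m)
  where
  h≢ : ∀ j → s ≤ j → j < m → h ≢ g j
  h≢ j s≤j j<m h≡gj = misses j s≤j j<m (≡⇒≡ᵇ (g j) h (sym h≡gj))
  h≤ : ∀ j → s ≤ j → j < m → h ≤ g j
  h≤ zero    z≤n  _ = h≤gs
  h≤ (suc j) s≤sj sj<m with m≤n⇒m<n∨m≡n s≤sj
  ... | inj₂ refl = h≤gs
  ... | inj₁ s<sj = ≤-trans (∸-monoˡ-≤ 1 (≤∧≢⇒< (h≤ j s≤j′ j<m′) (h≢ j s≤j′ j<m′))) (step j s≤j′ j<m′)
    where
    s≤j′ = ≤-pred s<sj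
    j<m′ = <⇒≤ sj<m

-- Horizontal distance along a path

horizAt : Path → Path → ℕ → ℕ
horizAt ν D j = horiz ν (pointAt D j)

countN-take-< : ∀ j (D : Path) {r} → drop j D ≡ N ∷ r → countN (take j D) < countN D
countN-take-< j D {r} eq = begin-strict
  countN (take j D)                         <⟨ m<m+n _ z<s ⟩
  countN (take j D) + countN (N ∷ r)        ≡⟨ cong (λ p → countN (take j D) + countN p) eq ⟨
  countN (take j D) + countN (drop j D)     ≡⟨ countN-take+drop j D ⟨
  countN D                                  ∎
  where open ≤-Reasoning

countN-take-<-2 : ∀ j (D : Path) {r} → drop j D ≡ N ∷ N ∷ r → 2 + countN (take j D) ≤ countN D
countN-take-<-2 j D {r} eq = begin
  2 + countN (take j D)                     ≡⟨ +-comm 2 _ ⟩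
  countN (take j D) + 2                     ≤⟨ +-monoʳ-≤ (countN (take j D)) (s≤s (s≤s z≤n)) ⟩
  countN (take j D) + countN (N ∷ N ∷ r)    ≡⟨ cong (λ p → countN (take j D) + countN p) eq ⟨
  countN (take j D) + countN (drop j D)     ≡⟨ countN-take+drop j D ⟨
  countN D                                  ∎
  where open ≤-Reasoning

horizAt-N : ∀ ν D j {r} → countN D ≡ countN ν → drop j D ≡ N ∷ r → horizAt ν D j ≤ horizAt ν D (suc j)
horizAt-N ν D j cN eq rewrite countE-take-suc j D eq | countN-take-suc j D eq =
  ∸-monoˡ-≤ (countE (take j D)) (Xν-mono ν _ (≤-trans (countN-take-< j D eq) (≤-reflexive cN)))

horizAt-E : ∀ ν D j {r} → drop j D ≡ E ∷ r → horizAt ν D (suc j) ≡ horizAt ν D j ∸ 1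
horizAt-E ν D j eq rewrite countE-take-suc j D eq | countN-take-suc j D eq =
  sym (trans (∸-+-assoc X (countE (take j D)) 1) (cong (X ∸_) (+-comm (countE (take j D)) 1)))
  where X = Xν ν (countN (take j D))

horizAt-step : ∀ ν D j → countN D ≡ countN ν → j < length D → horizAt ν D j ∸ 1 ≤ horizAt ν D (suc j)
horizAt-step ν D j cN j<len with ∃-drop≡∷ j D j<len
... | N , _ , eq = ≤-trans (m∸n≤m _ 1) (horizAt-N ν D j cN eq)
... | E , _ , eq = ≤-reflexive (sym (horizAt-E ν D j eq))

horizAt-drop⇒E : ∀ ν D j → countN D ≡ countN ν → j < length D
               → horizAt ν D (suc j) < horizAt ν D j → ∃[ r ] drop j D ≡ E ∷ r
horizAt-drop⇒E ν D j cN j<len dropped with ∃-drop≡∷ j D j<len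
... | N , _ , eq = ⊥-elim (<⇒≱ dropped (horizAt-N ν D j cN eq))
... | E , r , eq = r , eq

horizAt-end : ∀ ν D → IsDyck ν D → horizAt ν D (length D) ≡ 0
horizAt-end ν D (cN , cE , _) rewrite take-all (length D) D ≤-refl =
  m≤n⇒m∸n≡0 (≤-trans (Xν≤countE ν (countN D)) (≤-reflexive (sym cE)))

horizAt-NN : ∀ ν D j {r} → Unique (LA ν) → IsDyck ν D → drop j D ≡ N ∷ N ∷ r
           → horizAt ν D j < horizAt ν D (suc j)
horizAt-NN ν D j u (cN , _ , above) eq rewrite countE-take-suc j D eq | countN-take-suc j D eq =
  ∸-monoˡ-< (Xν-strict ν _ u (≤-trans (countN-take-<-2 j D eq) (≤-reflexive cN))) onOrAbove
  where
  onOrAbove : countE (take j D) ≤ Xν ν (countN (take j D))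
  onOrAbove = All-pointsFrom-take (λ p → proj₁ p ≤ Xν ν (proj₂ p)) 0 0 D j above
                (<⇒≤ (drop≡∷⇒<length j D eq))

-- Rotations and the out-degree

module _ {A : Set} where

  length-catMaybes-applyUpTo : ∀ (F : ℕ → Maybe A) g n
                             → length (catMaybes (map F (applyUpTo g n))) ≡ countUpTo (is-just ∘ F ∘ g) n
  length-catMaybes-applyUpTo F g zero    = refl
  length-catMaybes-applyUpTo F g (suc n) with F (g 0)
  ... | just _  = cong suc (length-catMaybes-applyUpTo F (g ∘ suc) n)
  ... | nothing = length-catMaybes-applyUpTo F (g ∘ suc) n

  All-catMaybes-applyUpTo : ∀ (P : A → Set) (F : ℕ → Maybe A) g n → (∀ j {a} → F (g j) ≡ just a → P a)
                          → All P (catMaybes (map F (applyUpTo g n)))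
  All-catMaybes-applyUpTo P F g zero    _  = []
  All-catMaybes-applyUpTo P F g (suc n) ok with F (g 0) in eq
  ... | just a  = ok 0 eq ∷ All-catMaybes-applyUpTo P F (g ∘ suc) n (ok ∘ suc)
  ... | nothing = All-catMaybes-applyUpTo P F (g ∘ suc) n (ok ∘ suc)

  Unique-catMaybes-applyUpTo : ∀ (F : ℕ → Maybe A) g n
                             → (∀ i j {a} → F (g i) ≡ just a → F (g j) ≡ just a → i ≡ j)
                             → Unique (catMaybes (map F (applyUpTo g n)))
  Unique-catMaybes-applyUpTo F g zero    _   = []
  Unique-catMaybes-applyUpTo F g (suc n) inj with F (g 0) in eq
  ... | just a  = All-catMaybes-applyUpTo (a ≢_) F (g ∘ suc) n a≢later ∷ Unique-catMaybes-applyUpTo F (g ∘ suc) n inj∘suc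
    where
    a≢later : ∀ j {b} → F (g (suc j)) ≡ just b → a ≢ b
    a≢later j eqj a≡b = 0≢1+n (inj 0 (suc j) eq (trans eqj (cong just (sym a≡b))))
    inj∘suc : ∀ i j {b} → F (g (suc i)) ≡ just b → F (g (suc j)) ≡ just b → i ≡ j
    inj∘suc i j eqi eqj = suc-injective (inj (suc i) (suc j) eqi eqj)
  ... | nothing = Unique-catMaybes-applyUpTo F (g ∘ suc) n (λ i j eqi eqj → suc-injective (inj (suc i) (suc j) eqi eqj))

  deduplicate-Unique : ∀ (_≟ₐ_ : DecidableEquality A) {xs} → Unique xs → deduplicate _≟ₐ_ xs ≡ xs
  deduplicate-Unique _≟ₐ_ {[]}     []           = refl
  deduplicate-Unique _≟ₐ_ {x ∷ xs} (x∉xs ∷ uxs) rewrite deduplicate-Unique _≟ₐ_ uxs = cong (x ∷_) (filter-all _ x∉xs)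

touchSearch : Path → Path → ℕ → Maybe ℕ
touchSearch ν D e = search (λ m → horizAt ν D m ≡ᵇ horizAt ν D (suc e)) (suc (suc e)) (length D ∸ suc e)

-- e is the index of the east step before r_i (so r_i is reached after suc e steps) and m that of t_i.
record Rotation (ν D : Path) (i : ℕ) (D' : Path) : Set where
  field
    e m      : ℕ
    valley-N : nthN D i ≡ just (suc e)
    valley-E : isEAt D e ≡ true
    touch    : touchSearch ν D e ≡ just m
    result   : D' ≡ take e D ++ (drop (suc e) (take m D) ++ E ∷ drop m D)

  inner suffix : Path
  inner  = drop (suc (suc e)) (take m D)
  suffix = drop m D

rotate-view : ∀ ν D i D' → rotate ν D i ≡ just D' → Rotation ν D i D'
rotate-view ν D i D' rot with nthN D i in valley-N
... | just (suc e) with isEAt D e in valley-E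
...   | true with touchSearch ν D e in touch
...     | just m = record
  { e = e ; m = m ; valley-N = valley-N ; valley-E = valley-E ; touch = touch
  ; result = sym (just-injective rot) }

rotate-≡ : ∀ ν D i e m → nthN D i ≡ just (suc e) → isEAt D e ≡ true → touchSearch ν D e ≡ just m
         → rotate ν D i ≡ just (take e D ++ (drop (suc e) (take m D) ++ E ∷ drop m D))
rotate-≡ ν D i e m valley-N valley-E touch rewrite valley-N | valley-E | touch = refl

touch-exists : ∀ ν D i e → IsDyck ν D → nthN D i ≡ just (suc e) → ∃[ m ] touchSearch ν D e ≡ just m
touch-exists ν D i e dyck@(cN , _) valley-N =
  search-complete (horizAt ν D) (horizAt ν D k) (suc k) (length D ∸ k) (length D)
    (horizAt-N ν D k cN N-at-k)
    k<len
    (s≤s (≤-reflexive (sym (m+[n∸m]≡n (<⇒≤ k<len)))))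
    (≤-trans (≤-reflexive (horizAt-end ν D dyck)) z≤n)
    (λ j _ j<len → horizAt-step ν D j cN j<len)
  where
  k = suc e
  N-at-k = nthN⇒drop≡N∷ D i k valley-N
  k<len : k < length D
  k<len = drop≡∷⇒<length k D N-at-k

module _ {ν D i D'} (R : Rotation ν D i D') where
  open Rotation R

  rotation-firstHit : IsFirstHit (λ j → horizAt ν D j ≡ᵇ horizAt ν D (suc e)) (suc (suc e)) (length D ∸ suc e) m
  rotation-firstHit = search-sound _ _ _ m touch

  rotation-N : drop (suc e) D ≡ N ∷ drop (suc (suc e)) D
  rotation-N = nthN⇒drop≡N∷ D i (suc e) valley-N

  rotation-touch≤length : m ≤ length D
  rotation-touch≤length =
    ≤-pred (≤-trans (IsFirstHit.upper rotation-firstHit) (≤-reflexive (cong suc (m+[n∸m]≡n (<⇒≤ e+1<len)))))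
    where e+1<len = drop≡∷⇒<length (suc e) D rotation-N

  private
    inner-N : drop (suc e) (take m D) ≡ N ∷ inner
    inner-N = drop-take≡∷ (suc e) m D rotation-N (IsFirstHit.lower rotation-firstHit)

  rotation-target : D' ≡ take e D ++ N ∷ (inner ++ E ∷ suffix)
  rotation-target = trans result (cong (λ t → take e D ++ (t ++ E ∷ suffix)) inner-N)

  rotation-source : D ≡ take e D ++ E ∷ N ∷ (inner ++ suffix)
  rotation-source = begin
    D                                                   ≡⟨ take++drop≡id e D ⟨
    take e D ++ drop e D                                ≡⟨ cong (take e D ++_) (isEAt⇒drop≡E∷ D e valley-E) ⟩
    take e D ++ E ∷ drop (suc e) D                      ≡⟨ cong (λ t → take e D ++ E ∷ t) split ⟩
    take e D ++ E ∷ N ∷ (inner ++ suffix)               ∎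
    where
    open ≡-Reasoning
    split : drop (suc e) D ≡ N ∷ (inner ++ suffix)
    split = trans (drop≡drop-take++drop (suc e) m D (<⇒≤ (IsFirstHit.lower rotation-firstHit)))
                  (cong (_++ suffix) inner-N)

rotations-differ : ∀ ν D i j D' → i < j → rotate ν D i ≡ just D' → rotate ν D j ≡ just D' → ⊥
rotations-differ ν D i j D' i<j roti rotj = N≢E (++-cancelˡ (take eᵢ D) _ _ (trans (sym (rotation-target Rᵢ)) viaE))
  where
  Rᵢ = rotate-view ν D i D' roti
  Rⱼ = rotate-view ν D j D' rotj
  open Rotation Rᵢ using () renaming (e to eᵢ)
  open Rotation Rⱼ using () renaming (e to eⱼ; m to mⱼ)
  eᵢ<eⱼ : eᵢ < eⱼ
  eᵢ<eⱼ = ≤-pred (nthN-strictMono D i j _ _ (Rotation.valley-N Rᵢ) (Rotation.valley-N Rⱼ) i<j)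
  rest = drop (suc eⱼ) (take mⱼ D) ++ E ∷ drop mⱼ D
  viaE : D' ≡ take eᵢ D ++ E ∷ (drop (suc eᵢ) (take eⱼ D) ++ rest)
  viaE = trans (Rotation.result Rⱼ)
               (trans (cong (_++ rest) (take≡take++∷ eᵢ eⱼ D (isEAt⇒drop≡E∷ D eᵢ (Rotation.valley-E Rᵢ)) eᵢ<eⱼ))
                      (++-assoc (take eᵢ D) _ _))
  N≢E : ∀ {p q : Path} → N ∷ p ≢ E ∷ q
  N≢E ()

rotate-injective : ∀ ν D i j D' → rotate ν D i ≡ just D' → rotate ν D j ≡ just D' → i ≡ j
rotate-injective ν D i j D' roti rotj with <-cmp i j
... | tri< i<j _ _ = ⊥-elim (rotations-differ ν D i j D' i<j roti rotj)
... | tri≈ _ i≡j _ = i≡j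
... | tri> _ _ j<i = ⊥-elim (rotations-differ ν D j i D' j<i rotj roti)

valleyAt⇒ : ∀ D i → valleyAt D i ≡ true → ∃[ e ] nthN D i ≡ just (suc e) × isEAt D e ≡ true
valleyAt⇒ D i isValley with nthN D i
... | just (suc e) = e , refl , isValley

is-just-rotate : ∀ ν D i → IsDyck ν D → is-just (rotate ν D i) ≡ valleyAt D i
is-just-rotate ν D i dyck with rotate ν D i in rot
... | just D' = sym (trans (cong (precededByE D) valley-N) valley-E)
  where open Rotation (rotate-view ν D i D' rot)
... | nothing with valleyAt D i in isValley
...   | false = refl
...   | true with valleyAt⇒ D i isValley
...     | e , valley-N , valley-E with touch-exists ν D i e dyck valley-N
...       | m , touch with () ← trans (sym rot) (rotate-≡ ν D i e m valley-N valley-E touch)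

outdeg≡valleys : ∀ ν D → IsDyck ν D → outdeg ν D ≡ valleys D
outdeg≡valleys ν D dyck@(cN , _) = begin
  outdeg ν D                                         ≡⟨ cong length (deduplicate-Unique Path-≟ distinct) ⟩
  length (catMaybes (map (rotate ν D) (upTo n)))     ≡⟨ length-catMaybes-applyUpTo (rotate ν D) id n ⟩
  countUpTo (is-just ∘ rotate ν D) n                 ≡⟨ countUpTo-cong _ _ n (λ i → is-just-rotate ν D i dyck) ⟩
  countUpTo (valleyAt D) n                           ≡⟨ cong (countUpTo (valleyAt D)) cN ⟨
  countUpTo (valleyAt D) (countN D)                  ≡⟨ countUpTo-valleyAt D ⟩
  valleys D                                          ∎
  where
  open ≡-Reasoning
  n = countN ν
  distinct = Unique-catMaybes-applyUpTo (rotate ν D) id n (λ i j → rotate-injective ν D i j _)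

-- Covers do not increase the number of valleys

lastIsE-before-touch : ∀ ν D k m b → countN D ≡ countN ν → suc k < m → m ≤ length D
                     → horizAt ν D k ≤ horizAt ν D (suc k)
                     → (∀ j → suc k ≤ j → j < m → ¬ T (horizAt ν D j ≡ᵇ horizAt ν D k))
                     → horizAt ν D m ≡ horizAt ν D k
                     → lastIsE b (drop (suc k) (take m D)) ≡ true
lastIsE-before-touch ν D k (suc m) b cN (s≤s k+1≤m) m+1≤len start misses touched =
  lastIsE-drop-take-suc (suc k) m D b k+1≤m (proj₂ (horizAt-drop⇒E ν D m cN m+1≤len dropped))
  where
  above : horizAt ν D k < horizAt ν D m
  above = stays-above (horizAt ν D) (horizAt ν D k) (suc k) (suc m) start misses
            (λ j _ j<m+1 → horizAt-step ν D j cN (≤-trans j<m+1 m+1≤len)) m k+1≤m ≤-refl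
  dropped : horizAt ν D (suc m) < horizAt ν D m
  dropped = subst (_< horizAt ν D m) (sym touched) above

inner-ends-with-E : ∀ {ν D i D'} → Unique (LA ν) → IsDyck ν D → (R : Rotation ν D i D')
                  → startsWithN (Rotation.suffix R) ≡ true → lastIsE false (Rotation.inner R) ≡ true
inner-ends-with-E {ν} {D} u dyck@(cN , _) R startsN = case m≤n⇒m<n∨m≡n lower of λ where
    (inj₂ k+1≡m) → ⊥-elim (<-irrefl (sym (trans (cong g k+1≡m) touched))
                                     (horizAt-NN ν D k u dyck (doubleN k+1≡m)))
    (inj₁ k+1<m) → lastIsE-before-touch ν D k m false cN k+1<m (rotation-touch≤length R)
                     (horizAt-N ν D k cN (rotation-N R)) before touched
  where
  open Rotation R
  open IsFirstHit (rotation-firstHit R)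
  k = suc e
  g = horizAt ν D
  touched : g m ≡ g k
  touched = ≡ᵇ⇒≡ (g m) (g k) hit
  doubleN : suc k ≡ m → drop k D ≡ N ∷ N ∷ proj₁ (startsWithN⇒ suffix startsN)
  doubleN refl = trans (rotation-N R) (cong (N ∷_) (proj₂ (startsWithN⇒ suffix startsN)))

valleys-cover-≤ : ∀ ν D i D' → Unique (LA ν) → IsDyck ν D → rotate ν D i ≡ just D' → valleys D' ≤ valleys D
valleys-cover-≤ ν D i D' u dyck rot =
  subst₂ _≤_ (cong valleys (sym (rotation-target R))) (cong valleys (sym (rotation-source R)))
         (valleys-rotate-≤ (take e D) inner suffix (inner-ends-with-E u dyck R))
  where
  R = rotate-view ν D i D' rot
  open Rotation R

valleys-antitone : ∀ {ν D D'} → Unique (LA ν) → D ≤T[ ν ] D' → valleys D' ≤ valleys D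
valleys-antitone u ε = ≤-refl
valleys-antitone u ((dyck , i , _ , rot) ◅ rest) = ≤-trans (valleys-antitone u rest) (valleys-cover-≤ _ _ i _ u dyck rot)

mainTheorem8 : (ν D D' : Path) → Unique (LA ν) → IsDyck ν D → IsDyck ν D'
    → D ≤T[ ν ] D' → outdeg ν D' ≤ outdeg ν D
mainTheorem8 ν D D' u dyck dyck' D≤D' = begin
  outdeg ν D' ≡⟨ outdeg≡valleys ν D' dyck' ⟩
  valleys D'  ≤⟨ valleys-antitone u D≤D' ⟩
  valleys D   ≡⟨ outdeg≡valleys ν D dyck ⟨
  outdeg ν D  ∎
  where open ≤-Reasoning
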